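{- Consider a stable Phase 2 of the Extending Window Method (setting below). If there exist $k_0\in\mathbb{N}$, $k_0\ge2$, and $(x_1,\dots,x_{k_0+1})\in\mathcal{B}^{k_0+1}$ such that (i) $\#\mathcal{Q}_{[x_1,\dots,x_{k_0}]}>1$, and (ii) there is an infinite walk in the Rauzy graph $G_{k_0}$ starting in the vertex $(x_2,\dots,x_{k_0+1})$, then Phase 2 does not converge.
   Context: Setting: $\beta$ an algebraic integer, $\mathcal{A}\subset\mathbb{Z}[\beta]$ a finite alphabet, $\mathcal{B}\subset\mathbb{Z}[\beta]$ a finite input alphabet with $\mathcal{A}\subsetneq\mathcal{B}\subset\mathcal{A}+\mathcal{A}$, and $\mathcal{Q}\subset\mathbb{Z}[\beta]$ a finite set with $0\in\mathcal{Q}$ and $\mathcal{B}+\mathcal{Q}\subset\mathcal{A}+\beta\mathcal{Q}$. Phase 2 chooses, for each $n\ge1$ and $(x_1,\dots,x_n)\in\mathcal{B}^n$, a set $\mathcal{Q}_{[x_1,\dots,x_n]}\subset\mathcal{Q}$ with $x_1+\mathcal{Q}\subset\mathcal{A}+\beta\mathcal{Q}_{[x_1]}$, and for $n\ge2$, $\mathcal{Q}_{[x_1,\dots,x_n]}\subset\mathcal{Q}_{[x_1,\dots,x_{n-1}]}$ and $x_1+\mathcal{Q}_{[x_2,\dots,x_n]}\subset\mathcal{A}+\beta\mathcal{Q}_{[x_1,\dots,x_n]}$. Phase 2 converges if there is $n$ with $\#\mathcal{Q}_{[x_1,\dots,x_n]}=1$ for all $(x_1,\dots,x_n)\in\mathcal{B}^n$.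 Phase 2 is stable if for all $k\ge2$ and all $(x_1,\dots,x_{k+1})\in\mathcal{B}^{k+1}$: $\mathcal{Q}_{[x_2,\dots,x_{k+1}]}=\mathcal{Q}_{[x_2,\dots,x_k]}$ implies $\mathcal{Q}_{[x_1,\dots,x_{k+1}]}=\mathcal{Q}_{[x_1,\dots,x_k]}$. For $k\ge2$, the Rauzy graph $G_k=(V_k,E_k)$ is the directed graph with vertex set $V_k=\{(y_1,\dots,y_k)\in\mathcal{B}^k: \#\mathcal{Q}_{[y_1,\dots,y_k]}=\#\mathcal{Q}_{[y_1,\dots,y_{k-1}]}\}$ and an edge $(y_1,\dots,y_k)\to(y'_1,\dots,y'_k)$ between vertices whenever $(y_2,\dots,y_k)=(y'_1,\dots,y'_{k-1})$. -}

module Defs where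

open import Level using (Level; _⊔_)
open import Algebra.Bundles using (CommutativeRing)
open import Data.Nat as ℕ using (ℕ; zero; suc; _≤_; _<_)
open import Data.Integer as ℤ using (ℤ; +_; -[1+_])
open import Data.Fin using (Fin)
open import Data.Fin.Subset using (Subset; _∈_; _⊆_; ∣_∣)
open import Data.List as List using (List; []; _∷_; _∷ʳ_; length)
open import Data.Vec as Vec using (Vec; lookup; toList; init; tail)
open import Data.Product using (Σ; ∃; ∃₂; _×_; _,_)
open import Relation.Nullary using (¬_)
open import Relation.Binary.PropositionalEquality using (_≡_)

module Setting {c ℓ : Level} (R : CommutativeRing c ℓ) where
  open CommutativeRing R

  _·ℕ_ : ℕ → Carrier → Carrier
  zero ·ℕ x = 0#
  suc n ·ℕ x = x + (n ·ℕ x)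

  ⟦_⟧ℤ : ℤ → Carrier
  ⟦ + n ⟧ℤ = n ·ℕ 1#
  ⟦ -[1+ n ] ⟧ℤ = - (suc n ·ℕ 1#)

  evalPoly : List ℤ → Carrier → Carrier
  evalPoly [] b = 0#
  evalPoly (a ∷ as) b = ⟦ a ⟧ℤ + b * evalPoly as b

  -- β is an algebraic integer: root of a monic integer polynomial
  AlgebraicInteger : Carrier → Set ℓ
  AlgebraicInteger β = Σ (List ℤ) λ cs → evalPoly (cs ∷ʳ + 1) β ≈ 0#

  InZ[_] : Carrier → Carrier → Set ℓ
  InZ[ β ] x = Σ (List ℤ) λ cs → x ≈ evalPoly cs β

  -- the entries of a vector are pairwise distinct (so the vector is a finite set)
  Distinct : ∀ {n} → Vec Carrier n → Set ℓ
  Distinct {n} v = ∀ (i j : Fin n) → lookup v i ≈ lookup v j → i ≡ j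

  -- The setting: β, alphabets 𝒜 (size nA), ℬ (size nB, letters = Fin nB),
  -- and 𝒬 (size m, elements indexed by Fin m).
  record Setup (nA nB m : ℕ) : Set (c ⊔ ℓ) where
    field
      β   : Carrier
      A   : Vec Carrier nA
      B   : Vec Carrier nB
      Q   : Vec Carrier m
      β-algInt : AlgebraicInteger β
      A-Zβ : ∀ i → InZ[ β ] (lookup A i)
      B-Zβ : ∀ i → InZ[ β ] (lookup B i)
      Q-Zβ : ∀ i → InZ[ β ] (lookup Q i)
      B-distinct : Distinct B
      Q-distinct : Distinct Q
      A⊆B : ∀ (i : Fin nA) → ∃ λ (j : Fin nB) → lookup A i ≈ lookup B j
      A≢B : ∃ λ (j : Fin nB) → ∀ (i : Fin nA) → ¬ (lookup A i ≈ lookup B j)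
      B⊆A+A : ∀ (j : Fin nB) → ∃₂ λ (i i' : Fin nA) → lookup B j ≈ lookup A i + lookup A i'
      0∈Q : ∃ λ (i : Fin m) → lookup Q i ≈ 0#
      B+Q⊆A+βQ : ∀ (j : Fin nB) (i : Fin m) →
        ∃₂ λ (a : Fin nA) (i' : Fin m) → lookup B j + lookup Q i ≈ lookup A a + β * lookup Q i'

  module _ {nA nB m : ℕ} (S : Setup nA nB m) where
    open Setup S

    _+_⊂𝒜+β_ : Fin nB → Subset m → Subset m → Set ℓ
    x + Q' ⊂𝒜+β Q'' = ∀ (i : Fin m) → i ∈ Q' →
      ∃₂ λ (a : Fin nA) (i' : Fin m) → i' ∈ Q'' × (lookup B x + lookup Q i ≈ lookup A a + β * lookup Q i')

    -- Phase 2: Qs w = 𝒬_[w] for nonempty words w over ℬ (the value at [] is unused).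
    record Phase2 : Set ℓ where
      field
        Qs : List (Fin nB) → Subset m
        first : ∀ (x : Fin nB) → ∀ (i : Fin m) →
          ∃₂ λ (a : Fin nA) (i' : Fin m) → i' ∈ Qs (x ∷ []) × (lookup B x + lookup Q i ≈ lookup A a + β * lookup Q i')
        decreasing : ∀ (w : List (Fin nB)) (z : Fin nB) → 1 ≤ length w → Qs (w ∷ʳ z) ⊆ Qs w
        extend : ∀ (x : Fin nB) (w : List (Fin nB)) → 1 ≤ length w → x + Qs w ⊂𝒜+β Qs (x ∷ w)

    module _ (P : Phase2) where
      open Phase2 P

      Converges : Set
      Converges = ∃ λ (n : ℕ) → 1 ≤ n × (∀ (w : Vec (Fin nB) n) → ∣ Qs (toList w) ∣ ≡ 1)

      -- for all k ≥ 2 and x₁ … x_{k+1}: written as x₁, mid = x₂…x_k (length k-1 ≥ 1), z = x_{k+1}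
      Stable : Set
      Stable = ∀ (x₁ : Fin nB) (mid : List (Fin nB)) (z : Fin nB) → 1 ≤ length mid →
        Qs (mid ∷ʳ z) ≡ Qs mid → Qs (x₁ ∷ (mid ∷ʳ z)) ≡ Qs (x₁ ∷ mid)

      -- Rauzy graph G_k with k = suc j (j ≥ 1 in applications)
      IsVertex : ∀ (j : ℕ) → Vec (Fin nB) (suc j) → Set
      IsVertex j y = ∣ Qs (toList y) ∣ ≡ ∣ Qs (toList (init y)) ∣

      Edge : ∀ (j : ℕ) → Vec (Fin nB) (suc j) → Vec (Fin nB) (suc j) → Set
      Edge j y y' = tail y ≡ init y'

      InfiniteWalkFrom : ∀ (j : ℕ) → Vec (Fin nB) (suc j) → Set
      InfiniteWalkFrom j v = Σ (ℕ → Vec (Fin nB) (suc j)) λ f →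
        f 0 ≡ v × (∀ (i : ℕ) → IsVertex j (f i) × Edge j (f i) (f (suc i)))

module Submission where

-- An infinite walk f 0, f 1, … in the Rauzy graph G_{j+1}
-- spells an infinite word y = y₀ y₁ … (y i = first letter of f i), and
-- f i = (y_i, …, y_{i+j}).  Being a vertex means that the window f i does not
-- shrink 𝒬 compared to its initial part; since 𝒬 only decreases along
-- extensions, 𝒬_[y_i … y_{i+j}] = 𝒬_[y_i … y_{i+j-1}] for every i.  Stability
-- propagates such an equality through any prefix, so by induction
--   𝒬_[x₁ y₀ … y_{n+j-1}] = 𝒬_[x₁ y₀ … y_{j-1}] = 𝒬_[x₁ x₂ … x_{k₀}]   for all n,
-- a set with more than one element.  If Phase 2 converged at length n+1, the
-- word x₁ y₀ … y_{n-1} would have a singleton 𝒬, and its extension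
-- x₁ y₀ … y_{n+j-1} a set of at most one element: a contradiction.

open import Defs
open import Level using (Level)
open import Algebra.Bundles using (CommutativeRing)
open import Data.Nat using (ℕ; zero; suc; _+_; _≤_; _<_; s≤s; z≤n)
open import Data.Nat.Properties
  using (suc-injective; <-irrefl; <⇒≱; +-suc; +-identityʳ; ≤-trans; m≤n+m; module ≤-Reasoning)
open import Data.Fin using (Fin)
open import Data.Fin.Subset using (Subset; _⊆_; ∣_∣; inside; outside)
open import Data.Fin.Subset.Properties using (p⊆q⇒∣p∣≤∣q∣; drop-∷-⊆; ⊆-trans; ⊆-reflexive)
open import Data.List using ([]; _∷_; _++_; _∷ʳ_; [_]; length)
open import Data.List.Properties using (++-assoc; ++-identityʳ; ∷ʳ-++; length-++)
open import Data.Vec as Vec using (Vec; toList; init; head; tail)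
open import Data.Vec.Properties using (toList-++; toList-∷ʳ; length-toList)
open import Data.Product using (_,_; proj₁; proj₂)
open import Function using (_∘_)
open import Relation.Binary.PropositionalEquality
  using (_≡_; refl; sym; trans; cong; cong₂; subst; module ≡-Reasoning)
open import Relation.Nullary using (¬_)

⊆-∧-∣∣≡⇒≡ : ∀ {m} {p q : Subset m} → p ⊆ q → ∣ p ∣ ≡ ∣ q ∣ → p ≡ q
⊆-∧-∣∣≡⇒≡ {p = Vec.[]} {Vec.[]} _ _ = refl
⊆-∧-∣∣≡⇒≡ {p = outside Vec.∷ p} {outside Vec.∷ q} p⊆q eq =
  cong (outside Vec.∷_) (⊆-∧-∣∣≡⇒≡ (drop-∷-⊆ p⊆q) eq)
⊆-∧-∣∣≡⇒≡ {p = outside Vec.∷ p} {inside Vec.∷ q} p⊆q eq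
  with () ← <-irrefl eq (s≤s (p⊆q⇒∣p∣≤∣q∣ (drop-∷-⊆ p⊆q)))
⊆-∧-∣∣≡⇒≡ {p = inside Vec.∷ p} {outside Vec.∷ q} p⊆q eq with () ← p⊆q Vec.here
⊆-∧-∣∣≡⇒≡ {p = inside Vec.∷ p} {inside Vec.∷ q} p⊆q eq =
  cong (inside Vec.∷_) (⊆-∧-∣∣≡⇒≡ (drop-∷-⊆ p⊆q) (suc-injective eq))

module Words {a} {A : Set a} where

  segment : (ℕ → A) → ℕ → (n : ℕ) → Vec A n
  segment y i zero = Vec.[]
  segment y i (suc n) = y i Vec.∷ segment y (suc i) n

  segment-∷ʳ : ∀ (y : ℕ → A) i n → segment y i (suc n) ≡ segment y i n Vec.∷ʳ y (i + n)
  segment-∷ʳ y i zero = cong (λ k → y k Vec.∷ Vec.[]) (sym (+-identityʳ i))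
  segment-∷ʳ y i (suc n) = cong (y i Vec.∷_)
    (trans (segment-∷ʳ y (suc i) n) (cong (λ k → segment y (suc i) n Vec.∷ʳ y k) (sym (+-suc i n))))

  toList-segment-∷ʳ : ∀ (y : ℕ → A) i n →
    toList (segment y i (suc n)) ≡ toList (segment y i n) ∷ʳ y (i + n)
  toList-segment-∷ʳ y i n = trans (cong toList (segment-∷ʳ y i n)) (toList-∷ʳ (y (i + n)) (segment y i n))

  segment-++ : ∀ (y : ℕ → A) i n d → segment y i (n + d) ≡ segment y i n Vec.++ segment y (i + n) d
  segment-++ y i zero d = cong (λ k → segment y k d) (sym (+-identityʳ i))
  segment-++ y i (suc n) d = cong (y i Vec.∷_)
    (trans (segment-++ y (suc i) n d) (cong (λ k → segment y (suc i) n Vec.++ segment y k d) (sym (+-suc i n))))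

  init-segment : ∀ (y : ℕ → A) i n → init (segment y i (suc n)) ≡ segment y i n
  init-segment y i zero = refl
  init-segment y i (suc n) = cong (y i Vec.∷_) (init-segment y (suc i) n)

  private
    head-∷-tail : ∀ {n} (v : Vec A (suc n)) → v ≡ head v Vec.∷ tail v
    head-∷-tail (x Vec.∷ v) = refl

    head-init : ∀ {n} (v : Vec A (suc (suc n))) → head (init v) ≡ head v
    head-init (x Vec.∷ v) = refl

    tail-init : ∀ {n} (v : Vec A (suc (suc n))) → tail (init v) ≡ init (tail v)
    tail-init (x Vec.∷ v) = refl

    vec-0 : (v : Vec A 0) → v ≡ Vec.[]
    vec-0 Vec.[] = refl

  -- The proof drops the last letter of
  -- every window, which again yields such a walk, one letter shorter.
  walk-spells : ∀ n (g : ℕ → Vec A (suc n)) (y : ℕ → A) →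
    (∀ i → head (g i) ≡ y i) → (∀ i → tail (g i) ≡ init (g (suc i))) →
    ∀ i → g i ≡ segment y i (suc n)
  walk-spells zero g y heads edges i =
    trans (head-∷-tail (g i)) (cong₂ Vec._∷_ (heads i) (vec-0 (tail (g i))))
  walk-spells (suc n) g y heads edges i =
    trans (head-∷-tail (g i)) (cong₂ Vec._∷_ (heads i)
      (trans (edges i) (walk-spells n (init ∘ g) y heads′ edges′ (suc i))))
    where
    heads′ : ∀ i → head (init (g i)) ≡ y i
    heads′ i = trans (head-init (g i)) (heads i)
    edges′ : ∀ i → tail (init (g i)) ≡ init (init (g (suc i)))
    edges′ i = trans (tail-init (g i)) (cong init (edges i))

open Words

module Phase2Facts {c ℓ : Level} (R : CommutativeRing c ℓ) {nA nB m : ℕ}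
    {S : Setting.Setup R nA nB m} (P : Setting.Phase2 R S) where
  open Setting R using (Stable)
  open Setting.Phase2 P

  Qs-antitone : ∀ x w v → Qs ((x ∷ w) ++ v) ⊆ Qs (x ∷ w)
  Qs-antitone x w [] = ⊆-reflexive (cong (Qs ∘ (x ∷_)) (++-identityʳ w))
  Qs-antitone x w (b ∷ v) =
    ⊆-trans (⊆-reflexive (cong (Qs ∘ (x ∷_)) (sym (∷ʳ-++ w b v))))
      (⊆-trans (Qs-antitone x (w ∷ʳ b) v) (decreasing (x ∷ w) b (s≤s z≤n)))

  same-size⇒same-Q : ∀ w z → 1 ≤ length w → ∣ Qs (w ∷ʳ z) ∣ ≡ ∣ Qs w ∣ → Qs (w ∷ʳ z) ≡ Qs w
  same-size⇒same-Q w z 1≤∣w∣ = ⊆-∧-∣∣≡⇒≡ (decreasing w z 1≤∣w∣)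

  stable-under-prefix : Stable S P → ∀ u w z → 1 ≤ length w →
    Qs (w ∷ʳ z) ≡ Qs w → Qs (u ++ (w ∷ʳ z)) ≡ Qs (u ++ w)
  stable-under-prefix stable [] w z 1≤∣w∣ eq = eq
  stable-under-prefix stable (b ∷ u) w z 1≤∣w∣ eq = begin
      Qs (b ∷ (u ++ (w ∷ʳ z)))  ≡⟨ cong (Qs ∘ (b ∷_)) (sym (++-assoc u w [ z ])) ⟩
      Qs (b ∷ ((u ++ w) ∷ʳ z))  ≡⟨ stable b (u ++ w) z 1≤∣uw∣ eq′ ⟩
      Qs (b ∷ (u ++ w))         ∎
    where
    open ≡-Reasoning
    1≤∣uw∣ : 1 ≤ length (u ++ w)
    1≤∣uw∣ = subst (1 ≤_) (sym (length-++ u)) (≤-trans 1≤∣w∣ (m≤n+m (length w) (length u)))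
    eq′ : Qs ((u ++ w) ∷ʳ z) ≡ Qs (u ++ w)
    eq′ = trans (cong Qs (++-assoc u w [ z ])) (stable-under-prefix stable u w z 1≤∣w∣ eq)

  SaturatedWindows : ℕ → (ℕ → Fin nB) → Set
  SaturatedWindows j y = ∀ i → Qs (toList (segment y i j) ∷ʳ y (i + j)) ≡ Qs (toList (segment y i j))

  saturation-propagates : Stable S P → ∀ j → 1 ≤ j → ∀ y → SaturatedWindows j y →
    ∀ n i u → Qs (u ++ toList (segment y i (n + j))) ≡ Qs (u ++ toList (segment y i j))
  saturation-propagates stable j 1≤j y saturated zero i u = refl
  saturation-propagates stable j 1≤j y saturated (suc n) i u = begin
      Qs (u ++ (y i ∷ toList (segment y (suc i) (n + j))))
        ≡⟨ cong Qs (sym (∷ʳ-++ u (y i) _)) ⟩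
      Qs ((u ∷ʳ y i) ++ toList (segment y (suc i) (n + j)))
        ≡⟨ saturation-propagates stable j 1≤j y saturated n (suc i) (u ∷ʳ y i) ⟩
      Qs ((u ∷ʳ y i) ++ toList (segment y (suc i) j))
        ≡⟨ cong Qs (trans (∷ʳ-++ u (y i) _) (cong (u ++_) (toList-segment-∷ʳ y i j))) ⟩
      Qs (u ++ (toList (segment y i j) ∷ʳ y (i + j)))
        ≡⟨ stable-under-prefix stable u _ _ 1≤∣window∣ (saturated i) ⟩
      Qs (u ++ toList (segment y i j)) ∎
    where
    open ≡-Reasoning
    1≤∣window∣ : 1 ≤ length (toList (segment y i j))
    1≤∣window∣ = subst (1 ≤_) (sym (length-toList (segment y i j))) 1≤j

  walk-saturated : ∀ j → 1 ≤ j → (f : ℕ → Vec (Fin nB) (suc j)) →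
    (∀ i → f i ≡ segment (head ∘ f) i (suc j)) →
    (∀ i → Setting.IsVertex R S P j (f i)) → SaturatedWindows j (head ∘ f)
  walk-saturated j 1≤j f spells vertex i =
    same-size⇒same-Q (toList (segment y i j)) (y (i + j)) 1≤∣window∣ (begin
      ∣ Qs (toList (segment y i j) ∷ʳ y (i + j)) ∣  ≡⟨ cong (∣_∣ ∘ Qs) (sym (toList-segment-∷ʳ y i j)) ⟩
      ∣ Qs (toList (segment y i (suc j))) ∣         ≡⟨ cong (∣_∣ ∘ Qs ∘ toList) (sym (spells i)) ⟩
      ∣ Qs (toList (f i)) ∣                          ≡⟨ vertex i ⟩
      ∣ Qs (toList (init (f i))) ∣                   ≡⟨ cong (∣_∣ ∘ Qs ∘ toList) (init-spells) ⟩
      ∣ Qs (toList (segment y i j)) ∣                ∎)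
    where
    open ≡-Reasoning
    y : ℕ → Fin nB
    y = head ∘ f
    1≤∣window∣ : 1 ≤ length (toList (segment y i j))
    1≤∣window∣ = subst (1 ≤_) (sym (length-toList (segment y i j))) 1≤j
    init-spells : init (f i) ≡ segment y i j
    init-spells = trans (cong init (spells i)) (init-segment y i j)

theorem21 : ∀ {c ℓ : Level} (R : CommutativeRing c ℓ) {nA nB m : ℕ}
    (S : Setting.Setup R nA nB m) (P : Setting.Phase2 R S) →
    Setting.Stable R S P →
    ∀ (j : ℕ) → 1 ≤ j → ∀ (x₁ : Fin nB) (rest : Vec (Fin nB) (suc j)) →
    1 < ∣ Setting.Phase2.Qs P (x₁ ∷ toList (init rest)) ∣ →
    Setting.InfiniteWalkFrom R S P j rest →
    ¬ Setting.Converges R S P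
theorem21 R {nB = nB} S P stable j 1≤j x₁ rest big (f , f₀≡rest , walk) (suc n , _ , converged) =
  <⇒≱ big ∣Q∣≤1
  where
  open Setting.Phase2 P
  open Phase2Facts R P
  open ≤-Reasoning
  y : ℕ → Fin nB
  y = head ∘ f
  spells : ∀ i → f i ≡ segment y i (suc j)
  spells = walk-spells j f y (λ _ → refl) (proj₂ ∘ walk)
  saturated : SaturatedWindows j y
  saturated = walk-saturated j 1≤j f spells (proj₁ ∘ walk)
  rest-spelled : init rest ≡ segment y 0 j
  rest-spelled = trans (cong init (sym f₀≡rest)) (trans (cong init (spells 0)) (init-segment y 0 j))
  ∣Q∣≤1 : ∣ Qs (x₁ ∷ toList (init rest)) ∣ ≤ 1
  ∣Q∣≤1 = begin
    ∣ Qs (x₁ ∷ toList (init rest)) ∣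
      ≡⟨ cong (∣_∣ ∘ Qs ∘ (x₁ ∷_) ∘ toList) rest-spelled ⟩
    ∣ Qs (x₁ ∷ toList (segment y 0 j)) ∣
      ≡⟨ cong ∣_∣ (sym (saturation-propagates stable j 1≤j y saturated n 0 [ x₁ ])) ⟩
    ∣ Qs (x₁ ∷ toList (segment y 0 (n + j))) ∣
      ≡⟨ cong (∣_∣ ∘ Qs ∘ (x₁ ∷_) ∘ toList) (segment-++ y 0 n j) ⟩
    ∣ Qs (x₁ ∷ toList (segment y 0 n Vec.++ segment y n j)) ∣
      ≡⟨ cong (∣_∣ ∘ Qs ∘ (x₁ ∷_)) (toList-++ (segment y 0 n) (segment y n j)) ⟩
    ∣ Qs (x₁ ∷ (toList (segment y 0 n) ++ toList (segment y n j))) ∣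
      ≤⟨ p⊆q⇒∣p∣≤∣q∣ (Qs-antitone x₁ _ _) ⟩
    ∣ Qs (x₁ ∷ toList (segment y 0 n)) ∣
      ≡⟨ converged (x₁ Vec.∷ segment y 0 n) ⟩
    1 ∎
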